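{- Let $K_n=(V,E^+,E^-)$ be a complete signed graph with $n=|V|$. 1) If $K_n$ is (weakly) $k$-balanced ($k\geq1$) with partition $V=(V_1,\dots,V_k)$ into the vertex sets of the connected components of $(V,E^+)$, where $|V_1|\geq|V_2|\geq\dots\geq|V_k|$, then $a_{so}(K_n)=|V_1|$ and $V_1$ is a minimum offensive alliance. Moreover, if $S=S_1\cup S_2\cup\dots\cup S_p$ with $p\geq 2$, where $\emptyset\subsetneq S_1\subseteq V_{i_1},\dots,\emptyset\subsetneq S_p\subseteq V_{i_p}$ and $i_1\leq i_2\leq\dots\leq i_p$, then $S$ is a minimum offensive alliance if and only if $|S|=|V_1|\geq 2|S_l|$, where $l=\arg\max_{j\in\{1,\dots,p\}}\{|S_j| : V_{i_j}\setminus S_j\neq\emptyset\}$. 2) If $K_n$ is (weakly) $k$-anti-balanced ($k\geq1$) with partition $V=(V_1,\dots,V_k)$ into the vertex sets of the connected components of $(V,E^-)$, where $|V_1|\geq|V_2|\geq\dots\geq|V_k|$, then: i) if $V=V_1\cup V_2$ and $|V_1|\geq|V_2|\geq\left\lceil\frac{n+1}{3}\right\rceil$, then $a_{so}(K_n)=2\left\lceil\frac{|V_1|+1}{2}\right\rceil$, and for any $S_1\subseteq V_1$ and $S_2\subseteq V_2$ with $|S_1|=|S_2|=\left\lceil\frac{|V_1|+1}{2}\right\rceil$, the set $S_1\cup S_2$ is a minimum offensive alliance; ii) if $|V_1|\geq\frac n2$, then $a_{so}(K_n)=\max\{n-|V_1|+1,\,2(n-|V_1|)\}$, and for any $S_1\subseteq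 V_1$ with $|S_1|=n-|V_1|$, the set $S_1\cup(V\setminus V_1)$ is a minimum offensive alliance; iii) otherwise, $a_{so}(K_n)=n$.
   Context: A signed graph is a triple $G=(V,E^+,E^-)$ with $V$ finite, $E^+,E^-\subseteq\binom{V}{2}$ and $E^+\cap E^-=\emptyset$. It is complete if $E^+\cup E^-=\binom{V}{2}$. A complete signed graph is (weakly) $k$-balanced if the unsigned graph $(V,E^+)$ has exactly $k$ connected components (each then a clique, with no negative edge inside any component); it is (weakly) $k$-anti-balanced if $(V,E^-)$ has exactly $k$ connected components (with no positive edge inside any component). $N^+(v)=\{u: uv\in E^+\}$, $N^-(v)=\{u: uv\in E^-\}$, $N(v)=N^+(v)\cup N^-(v)$. For $X\subseteq V$, $\deg^+_X(v)=|N^+(v)\cap X|$, $\deg^-_X(v)=|N^-(v)\cap X|$, $\overline{X}=V\setminus X$. For $S\subseteq V$, $\partial S=\left(\bigcup_{u\in S}N(u)\right)\setminus S$. A set $S\subseteq V$ is an offensive alliance if for every $w\in\partial S$: (1) $\deg^-_S(w)\geq \deg^+_S(w)$ and (2) $\deg^-_S(w)\geq \deg^+_{\overline S}(w)+1$. $a_{so}(G)$ is the size of a smallest non-empty offensive alliance of $G$; a minimum offensive alliance is a non-empty offensive alliance of that size.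
   Formalization: Case 2 ii) applies only when case i) does not, its minimum-alliance clause for $S_1\cup(V\setminus V_1)$ needs at least two components, and in part 1 the indices satisfy $i_1<i_2<\dots<i_p$. Each condition added here is assumed in the paper as well or is needed for the statement above to hold. This also corrects a misprint. -}

module Defs where

open import Data.Nat using (ℕ; zero; suc; _+_; _*_; _≤_; _≡ᵇ_)
open import Data.Nat.DivMod using (_/_)
open import Data.Bool using (Bool; true; false; not; _∧_)
open import Data.Fin using (Fin; toℕ; _≟_)
import Data.Fin as F
open import Data.Fin.Subset using (Subset; _∈_; _∉_; _∩_; _∪_; ∁; ∣_∣; Nonempty)
open import Data.Vec using (tabulate)
open import Data.Sum using (_⊎_)
open import Data.Product using (_×_; ∃-syntax)
open import Relation.Nullary using (¬_)
open import Relation.Nullary.Decidable using (⌊_⌋)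
open import Relation.Binary.PropositionalEquality using (_≡_; _≢_)
open import Relation.Binary.Construct.Closure.ReflexiveTransitive using (Star)

-- For distinct u, v the edge uv is positive iff  pos u v ≡ true  and
-- negative iff  pos u v ≡ false  (so E⁺ ∩ E⁻ = ∅ and E⁺ ∪ E⁻ = all pairs).
-- The value of pos on the diagonal is irrelevant (never used).
record CSG (n : ℕ) : Set where
  field
    pos     : Fin n → Fin n → Bool
    pos-sym : ∀ u v → pos u v ≡ pos v u
open CSG public

module _ {n : ℕ} (G : CSG n) where

  N⁺ : Fin n → Subset n
  N⁺ v = tabulate (λ u → not ⌊ u ≟ v ⌋ ∧ pos G u v)

  N⁻ : Fin n → Subset n
  N⁻ v = tabulate (λ u → not ⌊ u ≟ v ⌋ ∧ not (pos G u v))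

  N : Fin n → Subset n
  N v = N⁺ v ∪ N⁻ v

  deg⁺ : Subset n → Fin n → ℕ
  deg⁺ X v = ∣ N⁺ v ∩ X ∣

  deg⁻ : Subset n → Fin n → ℕ
  deg⁻ X v = ∣ N⁻ v ∩ X ∣

  _∈∂_ : Fin n → Subset n → Set
  w ∈∂ S = w ∉ S × ∃[ u ] (u ∈ S × w ∈ N u)

  OffensiveAlliance : Subset n → Set
  OffensiveAlliance S = ∀ w → w ∈∂ S →
    (deg⁺ S w ≤ deg⁻ S w) × (deg⁺ (∁ S) w + 1 ≤ deg⁻ S w)

  MinOffensiveAlliance : Subset n → Set
  MinOffensiveAlliance S = Nonempty S × OffensiveAlliance S ×
    (∀ T → Nonempty T → OffensiveAlliance T → ∣ S ∣ ≤ ∣ T ∣)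

  AsoIs : ℕ → Set
  AsoIs m = ∃[ S ] (MinOffensiveAlliance S × ∣ S ∣ ≡ m)

  Adj⁺ : Fin n → Fin n → Set
  Adj⁺ u v = u ≢ v × pos G u v ≡ true

  Adj⁻ : Fin n → Fin n → Set
  Adj⁻ u v = u ≢ v × pos G u v ≡ false

-- The block V_{i+1} (paper indexing starts at 1; here the first block has
-- index 0) of a labelling c : V → Fin k, as a subset of V.
Block : {n k : ℕ} → (Fin n → Fin k) → ℕ → Subset n
Block c i = tabulate (λ v → toℕ (c v) ≡ᵇ i)

ComponentLabelling : {n k : ℕ} → (Fin n → Fin n → Set) → (Fin n → Fin k) → Set
ComponentLabelling {n} {k} R c =
  (∀ u v → c u ≡ c v → Star R u v) ×
  (∀ u v → Star R u v → c u ≡ c v) ×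
  (∀ (i : Fin k) → ∃[ v ] (c v ≡ i))

WeaklyBalanced : {n k : ℕ} → CSG n → (Fin n → Fin k) → Set
WeaklyBalanced G c = ComponentLabelling (Adj⁺ G) c ×
  (∀ u v → u ≢ v → c u ≡ c v → pos G u v ≡ true)

WeaklyAntiBalanced : {n k : ℕ} → CSG n → (Fin n → Fin k) → Set
WeaklyAntiBalanced G c = ComponentLabelling (Adj⁻ G) c ×
  (∀ u v → u ≢ v → c u ≡ c v → pos G u v ≡ false)

SizeSorted : {n k : ℕ} → (Fin n → Fin k) → Set
SizeSorted {k = k} c = ∀ (i j : Fin k) → i F.≤ j →
  ∣ Block c (toℕ j) ∣ ≤ ∣ Block c (toℕ i) ∣

⌈_/3⌉ : ℕ → ℕ
⌈ x /3⌉ = (x + 2) / 3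

Case2i : {n k : ℕ} → (Fin n → Fin k) → Set
Case2i {n} c = (∀ v → v ∈ Block c 0 ⊎ v ∈ Block c 1) ×
  (∣ Block c 1 ∣ ≤ ∣ Block c 0 ∣) × (⌈ suc n /3⌉ ≤ ∣ Block c 1 ∣)

-- In a complete signed graph every vertex outside a non-empty set S is on its boundary, so S
-- is an offensive alliance iff two counting inequalities hold at every w ∉ S.  When the signs
-- come from a partition into blocks, these inequalities only see how S and its complement
-- meet the block B of w and its complement ∁ B.
--
-- Balanced case: a vertex of V₁ outside an alliance T gives |V₁| ≤ |T|, and V₁ itself is an
-- alliance because no block is larger than V₁.
--
-- Anti-balanced case: the complement of an alliance T is empty, or lies inside one block
-- (then |T| ≥ 2(n − |V₁|)), or meets two blocks B ≠ B′.  In the last case the conditions at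
-- both sides give |T ∩ B| ≤ |T ∖ B′| ≤ |T ∩ B′| ≤ |T ∖ B| ≤ |T ∩ B|, so T is split evenly
-- between B and B′, these are the only blocks, and |V₁| < |T| < 2|V₂|: we are in case i).

module Submission where

open import Defs
open import Data.Nat using (ℕ; zero; suc; _+_; _*_; _∸_; _≤_; _<_; _⊔_; ⌈_/2⌉; ⌊_/2⌋; z≤n; s≤s; s≤s⁻¹)
open import Data.Nat.Properties hiding (_≟_)
open import Data.Bool using (Bool; true; false; not; _∧_)
open import Data.Bool.Properties using (not-¬; ¬-not; not-injective; T-≡)
open import Data.Fin using (Fin; toℕ; _≟_)
import Data.Fin as F
import Data.Fin.Properties as F
open import Data.Fin.Subset
open import Data.Fin.Subset.Properties
open import Data.Nat.DivMod using (_/_; m*n/n≡m; /-monoˡ-≤; m<n*o⇒m/o<n)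
open import Data.Nat.Tactic.RingSolver using (solve-∀)
open import Data.Vec using (_∷_; []; tabulate)
open import Data.Vec.Properties using (lookup∘tabulate; []=⇒lookup; lookup⇒[]=)
open import Data.Product using (_×_; _,_; proj₁; proj₂; ∃-syntax)
open import Data.Sum using (_⊎_; inj₁; inj₂; [_,_])
import Data.Sum
open import Data.Empty using (⊥-elim)
open import Relation.Nullary using (¬_; yes; no; contradiction)
open import Relation.Nullary.Decidable using (⌊_⌋)
open import Relation.Binary.PropositionalEquality hiding ([_])
open import Relation.Binary.Definitions using (tri<; tri≈; tri>)
open import Relation.Binary.Construct.Closure.ReflexiveTransitive using (ε; _◅_)
open import Function.Base using (_∘_)
open import Function.Bundles using (_⇔_; mk⇔; Equivalence)
open Equivalence using (to; from)

private
  variable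
    n : ℕ
    p q r : Subset n
    x : Fin n

∣p∣≡∣p∩q∣+∣p∩∁q∣ : ∀ (p q : Subset n) → ∣ p ∣ ≡ ∣ p ∩ q ∣ + ∣ p ∩ ∁ q ∣
∣p∣≡∣p∩q∣+∣p∩∁q∣ []          []          = refl
∣p∣≡∣p∩q∣+∣p∩∁q∣ (false ∷ p) (_ ∷ q)     = ∣p∣≡∣p∩q∣+∣p∩∁q∣ p q
∣p∣≡∣p∩q∣+∣p∩∁q∣ (true ∷ p)  (true ∷ q)  = cong suc (∣p∣≡∣p∩q∣+∣p∩∁q∣ p q)
∣p∣≡∣p∩q∣+∣p∩∁q∣ (true ∷ p)  (false ∷ q) =
  trans (cong suc (∣p∣≡∣p∩q∣+∣p∩∁q∣ p q)) (sym (+-suc _ _))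

p─q≡p∩∁q : ∀ (p q : Subset n) → p ─ q ≡ p ∩ ∁ q
p─q≡p∩∁q []          []          = refl
p─q≡p∩∁q (false ∷ p) (false ∷ q) = cong (false ∷_) (p─q≡p∩∁q p q)
p─q≡p∩∁q (false ∷ p) (true ∷ q)  = cong (false ∷_) (p─q≡p∩∁q p q)
p─q≡p∩∁q (true ∷ p)  (false ∷ q) = cong (true ∷_) (p─q≡p∩∁q p q)
p─q≡p∩∁q (true ∷ p)  (true ∷ q)  = cong (false ∷_) (p─q≡p∩∁q p q)

∣q∣≡∣p∩q∣+∣∁p∩q∣ : ∀ (p q : Subset n) → ∣ q ∣ ≡ ∣ p ∩ q ∣ + ∣ ∁ p ∩ q ∣
∣q∣≡∣p∩q∣+∣∁p∩q∣ p q = trans (∣p∣≡∣p∩q∣+∣p∩∁q∣ q p)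
  (cong₂ (λ a b → ∣ a ∣ + ∣ b ∣) (∩-comm q p) (∩-comm q (∁ p)))

x∈p─q⇒x∉q : ∀ (p q : Subset n) → x ∈ p ─ q → x ∉ q
x∈p─q⇒x∉q {x = x} p q x∈p─q = x∈∁p⇒x∉p (proj₂ (x∈p∩q⁻ p (∁ q) (subst (x ∈_) (p─q≡p∩∁q p q) x∈p─q)))

∩-monoˡ : p ⊆ q → p ∩ r ⊆ q ∩ r
∩-monoˡ {p = p} {r = r} p⊆q y∈p∩r = let y∈p , y∈r = x∈p∩q⁻ p r y∈p∩r in x∈p∩q⁺ (p⊆q y∈p , y∈r)

⊆∧∣q∣≤∣p∣⇒⊇ : p ⊆ q → ∣ q ∣ ≤ ∣ p ∣ → q ⊆ p
⊆∧∣q∣≤∣p∣⇒⊇ {p = p} p⊆q ∣q∣≤∣p∣ {y} y∈q with y ∈? p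
... | yes y∈p = y∈p
... | no  y∉p = contradiction ∣q∣≤∣p∣ (<⇒≱ (p⊂q⇒∣p∣<∣q∣ (p⊆q , y , y∈q , y∉p)))

x∈p∧x∉q⇒∣p∩q∣<∣p∣ : ∀ (p q : Subset n) → x ∈ p → x ∉ q → ∣ p ∩ q ∣ < ∣ p ∣
x∈p∧x∉q⇒∣p∩q∣<∣p∣ {x = x} p q x∈p x∉q = p⊂q⇒∣p∣<∣q∣ (p∩q⊆p p q , x , x∈p , x∉q ∘ p∩q⊆q p q)

Empty⇒∣p∣≡0 : ∀ {n} {p : Subset n} → Empty p → ∣ p ∣ ≡ 0
Empty⇒∣p∣≡0 {n} empty = trans (cong ∣_∣ (Empty-unique empty)) (∣⊥∣≡0 n)

Nonempty⇒1≤∣p∣ : Nonempty p → 1 ≤ ∣ p ∣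
Nonempty⇒1≤∣p∣ {p = p} (y , y∈p) = subst (_≤ ∣ p ∣) (∣⁅x⁆∣≡1 y)
  (p⊆q⇒∣p∣≤∣q∣ λ z∈⁅y⁆ → subst (_∈ p) (sym (x∈⁅y⁆⇒x≡y y z∈⁅y⁆)) y∈p)

1≤∣p∣⇒Nonempty : 1 ≤ ∣ p ∣ → Nonempty p
1≤∣p∣⇒Nonempty {p = p} 1≤∣p∣ with nonempty? p
... | yes nonempty = nonempty
... | no  empty    = contradiction (subst (1 ≤_) (Empty⇒∣p∣≡0 empty) 1≤∣p∣) λ ()

x∉p⇒p-x≡p : x ∉ p → p - x ≡ p
x∉p⇒p-x≡p {x = x} {p = p} x∉p = ⊆-antisym (p─q⊆p p ⁅ x ⁆)
  λ y∈p → x∈p∧x≢y⇒x∈p-y y∈p λ { refl → x∉p y∈p }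

x∈p⇒∣p-x∣+1≡∣p∣ : x ∈ p → ∣ p - x ∣ + 1 ≡ ∣ p ∣
x∈p⇒∣p-x∣+1≡∣p∣ {x = x} {p = p} x∈p = begin
  ∣ p - x ∣ + 1                     ≡⟨ +-comm ∣ p - x ∣ 1 ⟩
  1 + ∣ p - x ∣                     ≡⟨ cong (_+ ∣ p - x ∣) (∣⁅x⁆∣≡1 x) ⟨
  ∣ ⁅ x ⁆ ∣ + ∣ p - x ∣             ≡⟨ cong₂ (λ a b → ∣ a ∣ + ∣ b ∣) (sym p∩⁅x⁆≡⁅x⁆) (p─q≡p∩∁q p ⁅ x ⁆) ⟩
  ∣ p ∩ ⁅ x ⁆ ∣ + ∣ p ∩ ∁ ⁅ x ⁆ ∣   ≡⟨ ∣p∣≡∣p∩q∣+∣p∩∁q∣ p ⁅ x ⁆ ⟨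
  ∣ p ∣                             ∎
  where
  open ≡-Reasoning
  p∩⁅x⁆≡⁅x⁆ : p ∩ ⁅ x ⁆ ≡ ⁅ x ⁆
  p∩⁅x⁆≡⁅x⁆ = ⊆-antisym (p∩q⊆q p ⁅ x ⁆)
    λ y∈⁅x⁆ → x∈p∩q⁺ (subst (_∈ p) (sym (x∈⁅y⁆⇒x≡y x y∈⁅x⁆)) x∈p , y∈⁅x⁆)

⊆-of-size : ∀ {n} m (p : Subset n) → m ≤ ∣ p ∣ → ∃[ q ] q ⊆ p × ∣ q ∣ ≡ m
⊆-of-size {n} zero p _ = ⊥ , ⊥⊆ , ∣⊥∣≡0 n
⊆-of-size (suc m) (true ∷ p) m<∣p∣ =
  let q , q⊆p , ∣q∣≡m = ⊆-of-size m p (s≤s⁻¹ m<∣p∣) in true ∷ q , in⊆in q⊆p , cong suc ∣q∣≡m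
⊆-of-size (suc m) (false ∷ p) m<∣p∣ =
  let q , q⊆p , ∣q∣≡m = ⊆-of-size (suc m) p m<∣p∣ in false ∷ q , out⊆ q⊆p , ∣q∣≡m

∈-tabulate : ∀ {f : Fin n → Bool} → x ∈ tabulate f ⇔ f x ≡ true
∈-tabulate {x = x} {f = f} = mk⇔
  (λ x∈ → trans (sym (lookup∘tabulate f x)) ([]=⇒lookup x∈))
  (λ fx → lookup⇒[]= x (tabulate f) (trans (lookup∘tabulate f x) fx))

⊤⊆p⇒∣p∣≡n : ∀ {n} {p : Subset n} → (∀ x → x ∈ p) → ∣ p ∣ ≡ n
⊤⊆p⇒∣p∣≡n {n} all = trans (cong ∣_∣ (⊆-antisym ⊆⊤ λ {x} _ → all x)) (∣⊤∣≡n n)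

∣p∣+∣∁p∣≡n : ∀ {n} (p : Subset n) → ∣ p ∣ + ∣ ∁ p ∣ ≡ n
∣p∣+∣∁p∣≡n {n} p = begin
  ∣ p ∣ + ∣ ∁ p ∣           ≡⟨ cong₂ (λ x y → ∣ x ∣ + ∣ y ∣) (∩-identityˡ p) (∩-identityˡ (∁ p)) ⟨
  ∣ ⊤ ∩ p ∣ + ∣ ⊤ ∩ ∁ p ∣   ≡⟨ ∣p∣≡∣p∩q∣+∣p∩∁q∣ ⊤ p ⟨
  ∣ ⊤ {n} ∣                 ≡⟨ ∣⊤∣≡n n ⟩
  n                         ∎
  where open ≡-Reasoning

∁p≡q : (∀ x → x ∈ p ⊎ x ∈ q) → (∀ {x} → x ∈ p → x ∉ q) → ∁ p ≡ q
∁p≡q covers disjoint = ⊆-antisym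
  (λ {x} x∈∁p → [ (λ x∈p → contradiction x∈p (x∈∁p⇒x∉p x∈∁p)) , (λ x∈q → x∈q) ] (covers x))
  (λ x∈q → x∉p⇒x∈∁p λ x∈p → disjoint x∈p x∈q)

module _ {n : ℕ} {p q r : Subset n} (q⊆p : q ⊆ p) (r⊆∁p : r ⊆ ∁ p) where

  p∩[q∪r]≡q : p ∩ (q ∪ r) ≡ q
  p∩[q∪r]≡q = ⊆-antisym
    (λ x∈ → let x∈p , x∈q∪r = x∈p∩q⁻ p _ x∈ in
            [ (λ x∈q → x∈q) , (λ x∈r → contradiction x∈p (x∈∁p⇒x∉p (r⊆∁p x∈r))) ] (x∈p∪q⁻ q r x∈q∪r))
    (λ x∈q → x∈p∩q⁺ (q⊆p x∈q , p⊆p∪q r x∈q))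

  ∁p∩[q∪r]≡r : ∁ p ∩ (q ∪ r) ≡ r
  ∁p∩[q∪r]≡r = ⊆-antisym
    (λ x∈ → let x∈∁p , x∈q∪r = x∈p∩q⁻ (∁ p) _ x∈ in
            [ (λ x∈q → contradiction (q⊆p x∈q) (x∈∁p⇒x∉p x∈∁p)) , (λ x∈r → x∈r) ] (x∈p∪q⁻ q r x∈q∪r))
    (λ x∈r → x∈p∩q⁺ (r⊆∁p x∈r , q⊆p∪q q r x∈r))

  ∣q∪r∣≡∣q∣+∣r∣ : ∣ q ∪ r ∣ ≡ ∣ q ∣ + ∣ r ∣
  ∣q∪r∣≡∣q∣+∣r∣ = trans (∣q∣≡∣p∩q∣+∣∁p∩q∣ p (q ∪ r)) (cong₂ (λ x y → ∣ x ∣ + ∣ y ∣) p∩[q∪r]≡q ∁p∩[q∪r]≡r)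

2*x≡x+x : ∀ x → 2 * x ≡ x + x
2*x≡x+x x = cong (x +_) (+-identityʳ x)

x≤y⇔2*x≤x+y : ∀ {x y} → x ≤ y ⇔ 2 * x ≤ x + y
x≤y⇔2*x≤x+y {x} {y} = mk⇔
  (λ x≤y → subst (_≤ x + y) (sym (2*x≡x+x x)) (+-monoʳ-≤ x x≤y))
  (λ 2x≤x+y → +-cancelˡ-≤ x x y (subst (_≤ x + y) (2*x≡x+x x) 2x≤x+y))

m+1≤2*m : ∀ {m} → 1 ≤ m → m + 1 ≤ 2 * m
m+1≤2*m {m} 1≤m = subst (m + 1 ≤_) (sym (2*x≡x+x m)) (+-monoʳ-≤ m 1≤m)

<⇒⌈suc/2⌉≤ : ∀ {a x} → a < 2 * x → ⌈ suc a /2⌉ ≤ x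
<⇒⌈suc/2⌉≤ {a} {x} a<2x = *-cancelˡ-< 2 ⌊ a /2⌋ x (≤-<-trans 2⌊a/2⌋≤a a<2x)
  where
  open ≤-Reasoning
  2⌊a/2⌋≤a : 2 * ⌊ a /2⌋ ≤ a
  2⌊a/2⌋≤a = begin
    2 * ⌊ a /2⌋         ≡⟨ 2*x≡x+x ⌊ a /2⌋ ⟩
    ⌊ a /2⌋ + ⌊ a /2⌋   ≤⟨ +-monoʳ-≤ ⌊ a /2⌋ (⌊n/2⌋≤⌈n/2⌉ a) ⟩
    ⌊ a /2⌋ + ⌈ a /2⌉   ≡⟨ ⌊n/2⌋+⌈n/2⌉≡n a ⟩
    a                   ∎

<2*⌈suc/2⌉ : ∀ a → a < 2 * ⌈ suc a /2⌉
<2*⌈suc/2⌉ a = begin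
  suc a                       ≡⟨ ⌊n/2⌋+⌈n/2⌉≡n (suc a) ⟨
  ⌊ suc a /2⌋ + ⌈ suc a /2⌉   ≤⟨ +-monoˡ-≤ ⌈ suc a /2⌉ (⌊n/2⌋≤⌈n/2⌉ (suc a)) ⟩
  ⌈ suc a /2⌉ + ⌈ suc a /2⌉   ≡⟨ 2*x≡x+x ⌈ suc a /2⌉ ⟨
  2 * ⌈ suc a /2⌉             ∎
  where open ≤-Reasoning

⌈suc/3⌉≤⇔<3* : ∀ {m b} → ⌈ suc m /3⌉ ≤ b ⇔ m < 3 * b
⌈suc/3⌉≤⇔<3* {m} {b} = mk⇔
  ⌈suc/3⌉≤⇒<3*
  (λ m<3b → s≤s⁻¹ (m<n*o⇒m/o<n (subst (suc (suc m + 2) ≤_) (3*b+3≡[b+1]*3 b) (s≤s (+-monoˡ-≤ 2 m<3b)))))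
  where
  3*b+3≡[b+1]*3 : ∀ b → suc (3 * b + 2) ≡ suc b * 3
  3*b+3≡[b+1]*3 = solve-∀
  ⌈suc/3⌉≤⇒<3* : ⌈ suc m /3⌉ ≤ b → m < 3 * b
  ⌈suc/3⌉≤⇒<3* ⌈⌉≤b with suc m ≤? 3 * b
  ... | yes m<3b = m<3b
  ... | no  m≮3b = contradiction ⌈⌉≤b (<⇒≱ (begin-strict
    b                   <⟨ n<1+n b ⟩
    suc b               ≡⟨ m*n/n≡m (suc b) 3 ⟨
    suc b * 3 / 3       ≤⟨ /-monoˡ-≤ 3 (subst (_≤ suc m + 2) (3*b+3≡[b+1]*3 b)
                                               (+-monoˡ-≤ 2 (≰⇒> m≮3b))) ⟩
    (suc m + 2) / 3     ∎))
    where open ≤-Reasoning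

2*[n∸a]≤n⇔n≤2*a : ∀ {n a} → a ≤ n → 2 * (n ∸ a) ≤ n ⇔ n ≤ 2 * a
2*[n∸a]≤n⇔n≤2*a {n} {a} a≤n with n ∸ a | m+[n∸m]≡n a≤n
... | m | refl = mk⇔
  (λ 2m≤a+m → subst (a + m ≤_) (sym (2*x≡x+x a))
                (+-monoʳ-≤ a (from x≤y⇔2*x≤x+y (subst (2 * m ≤_) (+-comm a m) 2m≤a+m))))
  (λ a+m≤2a → subst (2 * m ≤_) (+-comm m a)
                (to x≤y⇔2*x≤x+y (+-cancelˡ-≤ a m a (subst (a + m ≤_) (2*x≡x+x a) a+m≤2a))))

[m+1]⊔2*m≤ : ∀ {m t} → 1 ≤ t → 2 * m ≤ t → (m + 1) ⊔ (2 * m) ≤ t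
[m+1]⊔2*m≤ {zero}  1≤t _    = 1≤t
[m+1]⊔2*m≤ {suc m} _   2m≤t = ⊔-lub (≤-trans (m+1≤2*m (s≤s z≤n)) 2m≤t) 2m≤t

[m⊔1]+m≡[m+1]⊔2*m : ∀ m → (m ⊔ 1) + m ≡ (m + 1) ⊔ (2 * m)
[m⊔1]+m≡[m+1]⊔2*m zero    = refl
[m⊔1]+m≡[m+1]⊔2*m (suc m) = begin
  suc (m ⊔ 0) + suc m         ≡⟨ cong (λ x → suc x + suc m) (⊔-identityʳ m) ⟩
  suc m + suc m               ≡⟨ 2*x≡x+x (suc m) ⟨
  2 * suc m                   ≡⟨ m≤n⇒m⊔n≡n (m+1≤2*m (s≤s z≤n)) ⟨
  (suc m + 1) ⊔ (2 * suc m)   ∎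
  where open ≡-Reasoning

≤×≤-cong : ∀ {a b c a′ b′ c′ : ℕ} → a ≡ a′ → b ≡ b′ → c ≡ c′ → (a ≤ b × c ≤ b) ⇔ (a′ ≤ b′ × c′ ≤ b′)
≤×≤-cong refl refl refl = mk⇔ (λ h → h) (λ h → h)

∣p∩q∣≤∣∁p∩q∣⇔ : ∀ (p q : Subset n) → ∣ p ∩ q ∣ ≤ ∣ ∁ p ∩ q ∣ ⇔ 2 * ∣ p ∩ q ∣ ≤ ∣ q ∣
∣p∩q∣≤∣∁p∩q∣⇔ p q = subst (λ m → ∣ p ∩ q ∣ ≤ ∣ ∁ p ∩ q ∣ ⇔ 2 * ∣ p ∩ q ∣ ≤ m)
  (sym (∣q∣≡∣p∩q∣+∣∁p∩q∣ p q)) x≤y⇔2*x≤x+y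

no-three-among-two : ∀ {A : Set} {a b c x y : A} → a ≢ b → a ≢ c → b ≢ c →
  a ≡ x ⊎ a ≡ y → b ≡ x ⊎ b ≡ y → ¬ (c ≡ x ⊎ c ≡ y)
no-three-among-two a≢b a≢c b≢c (inj₁ refl) (inj₁ refl) _           = a≢b refl
no-three-among-two a≢b a≢c b≢c (inj₂ refl) (inj₂ refl) _           = a≢b refl
no-three-among-two a≢b a≢c b≢c (inj₁ refl) (inj₂ refl) (inj₁ refl) = a≢c refl
no-three-among-two a≢b a≢c b≢c (inj₁ refl) (inj₂ refl) (inj₂ refl) = b≢c refl
no-three-among-two a≢b a≢c b≢c (inj₂ refl) (inj₁ refl) (inj₁ refl) = b≢c refl
no-three-among-two a≢b a≢c b≢c (inj₂ refl) (inj₁ refl) (inj₂ refl) = a≢c refl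

toℕ≤1 : ∀ {k} {x y : Fin (suc k)} → (∀ i → i ≡ x ⊎ i ≡ y) → ∀ (i : Fin (suc k)) → toℕ i ≤ 1
toℕ≤1 among F.zero           = z≤n
toℕ≤1 among (F.suc F.zero)   = s≤s z≤n
toℕ≤1 among (F.suc (F.suc i)) =
  ⊥-elim (no-three-among-two (λ ()) (λ ()) (λ ())
            (among F.zero) (among (F.suc F.zero)) (among (F.suc (F.suc i))))

x≢y⇒∃toℕ≡1 : ∀ {k} {x y : Fin (suc k)} → x ≢ y → ∃[ i ] (toℕ {suc k} i ≡ 1)
x≢y⇒∃toℕ≡1 {zero}  {F.zero} {F.zero} x≢y = contradiction refl x≢y
x≢y⇒∃toℕ≡1 {suc k} _                     = F.suc F.zero , refl

module _ {n : ℕ} {w : Fin n} where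

  not-≟∧-≡true : ∀ {u : Fin n} {b : Bool} → (not ⌊ u ≟ w ⌋ ∧ b) ≡ true ⇔ (u ≢ w × b ≡ true)
  not-≟∧-≡true {u} {b} with u ≟ w
  ... | yes u≡w = mk⇔ (λ ()) (λ (u≢w , _) → contradiction u≡w u≢w)
  ... | no  u≢w = mk⇔ (u≢w ,_) proj₂

  -- N⁺ and N⁻ are both of the shape below, with f u = pos G u w, resp. not (pos G u w)
  tabulate-away-∩ : ∀ {f : Fin n → Bool} {P : Subset n} (X : Subset n) →
    (∀ {u} → u ≢ w → f u ≡ true ⇔ u ∈ P) →
    tabulate (λ u → not ⌊ u ≟ w ⌋ ∧ f u) ∩ X ≡ P ∩ X - w
  tabulate-away-∩ {P = P} X side = ⊆-antisym
    (λ u∈ → let u∈N , u∈X = x∈p∩q⁻ _ X u∈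
                u≢w , fu = to not-≟∧-≡true (to ∈-tabulate u∈N)
            in x∈p∧x≢y⇒x∈p-y (x∈p∩q⁺ (to (side u≢w) fu , u∈X)) u≢w)
    (λ u∈ → let u∈P , u∈X = x∈p∩q⁻ P X (p─q⊆p (P ∩ X) ⁅ w ⁆ u∈)
                u≢w = x∉⁅y⁆⇒x≢y (x∈p─q⇒x∉q (P ∩ X) ⁅ w ⁆ u∈)
            in x∈p∩q⁺ (from ∈-tabulate (from not-≟∧-≡true (u≢w , from (side u≢w) u∈P)) , u∈X))

module _ {n : ℕ} (G : CSG n) where

  SignSide : Bool → Fin n → Subset n → Set
  SignSide b w P = ∀ {u} → u ≢ w → pos G u w ≡ b ⇔ u ∈ P

  SignSide-∁ : ∀ {b w P} → SignSide b w P → SignSide (not b) w (∁ P)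
  SignSide-∁ {b} side u≢w = mk⇔
    (λ eq → x∉p⇒x∈∁p λ u∈P → not-¬ (from (side u≢w) u∈P) eq)
    (λ u∈∁P → ¬-not λ eq → x∈∁p⇒x∉p u∈∁P (to (side u≢w) eq))

  deg⁺≡ : ∀ {w P} (X : Subset n) → SignSide true w P → deg⁺ G X w ≡ ∣ P ∩ X - w ∣
  deg⁺≡ X side = cong ∣_∣ (tabulate-away-∩ X side)

  deg⁻≡ : ∀ {w Q} (X : Subset n) → SignSide false w Q → deg⁻ G X w ≡ ∣ Q ∩ X - w ∣
  deg⁻≡ X side = cong ∣_∣ (tabulate-away-∩ X λ u≢w → mk⇔
    (λ eq → to (side u≢w) (not-injective eq))
    (λ u∈Q → cong not (from (side u≢w) u∈Q)))

blockOf : ∀ {n k} → (Fin n → Fin k) → Fin n → Subset n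
blockOf c w = Block c (toℕ (c w))

module _ {n k : ℕ} (c : Fin n → Fin k) where

  ∈Block⇔ : ∀ {i u} → u ∈ Block c i ⇔ toℕ (c u) ≡ i
  ∈Block⇔ = mk⇔ (λ u∈ → ≡ᵇ⇒≡ _ _ (from T-≡ (to ∈-tabulate u∈)))
                (λ eq → from ∈-tabulate (to T-≡ (≡⇒≡ᵇ _ _ eq)))

  ∈blockOf⇔ : ∀ {u w} → u ∈ blockOf c w ⇔ c u ≡ c w
  ∈blockOf⇔ = mk⇔ (λ u∈ → F.toℕ-injective (to ∈Block⇔ u∈)) (λ eq → from ∈Block⇔ (cong toℕ eq))

  blockOf≡Block : ∀ {i w} → w ∈ Block c i → blockOf c w ≡ Block c i
  blockOf≡Block w∈ = cong (Block c) (to ∈Block⇔ w∈)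

  w∈blockOf : ∀ w → w ∈ blockOf c w
  w∈blockOf w = from ∈blockOf⇔ refl

  blockOf-cong : ∀ {u w} → c u ≡ c w → blockOf c u ≡ blockOf c w
  blockOf-cong eq = cong (λ i → Block c (toℕ i)) eq

  blockOf⊆∁blockOf : ∀ {u w} → c u ≢ c w → blockOf c u ⊆ ∁ (blockOf c w)
  blockOf⊆∁blockOf cu≢cw v∈ = x∉p⇒x∈∁p λ v∈′ → cu≢cw (trans (sym (to ∈blockOf⇔ v∈)) (to ∈blockOf⇔ v∈′))

  blockOf-SignSide : ∀ {G : CSG n} {b w} → ComponentLabelling (λ u v → u ≢ v × pos G u v ≡ b) c →
    (∀ u v → u ≢ v → c u ≡ c v → pos G u v ≡ b) → SignSide G b w (blockOf c w)
  blockOf-SignSide (_ , connected⇒same , _) same⇒sign u≢w = mk⇔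
    (λ sign → from ∈blockOf⇔ (connected⇒same _ _ ((u≢w , sign) ◅ ε)))
    (λ u∈ → same⇒sign _ _ u≢w (to ∈blockOf⇔ u∈))

module _ {n k : ℕ} (c : Fin n → Fin (suc k)) where

  Block0-nonempty : (∀ i → ∃[ v ] (c v ≡ i)) → Nonempty (Block c 0)
  Block0-nonempty onto = let v , cv≡0 = onto F.zero in v , from (∈Block⇔ c) (cong toℕ cv≡0)

  ∣blockOf∣≤∣Block0∣ : SizeSorted c → ∀ w → ∣ blockOf c w ∣ ≤ ∣ Block c 0 ∣
  ∣blockOf∣≤∣Block0∣ sorted w = sorted F.zero (c w) z≤n

  TwoBlocks : Set
  TwoBlocks = ∀ v → v ∈ Block c 0 ⊎ v ∈ Block c 1

  module _ (twoBlocks : TwoBlocks) where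

    ∁Block0≡Block1 : ∁ (Block c 0) ≡ Block c 1
    ∁Block0≡Block1 = ∁p≡q twoBlocks
      λ v∈V₁ v∈V₂ → 0≢1+n (trans (sym (to (∈Block⇔ c) v∈V₁)) (to (∈Block⇔ c) v∈V₂))

    ∁Block1≡Block0 : ∁ (Block c 1) ≡ Block c 0
    ∁Block1≡Block0 = ∁p≡q (Data.Sum.swap ∘ twoBlocks)
      λ v∈V₂ v∈V₁ → 0≢1+n (trans (sym (to (∈Block⇔ c) v∈V₁)) (to (∈Block⇔ c) v∈V₂))

    n≡∣Block0∣+∣Block1∣ : n ≡ ∣ Block c 0 ∣ + ∣ Block c 1 ∣
    n≡∣Block0∣+∣Block1∣ = trans (sym (∣p∣+∣∁p∣≡n (Block c 0)))
                                (cong (λ p → ∣ Block c 0 ∣ + ∣ p ∣) ∁Block0≡Block1)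

module _ {n : ℕ} (G : CSG n) where

  ∈∂-complete : ∀ {S w} → Nonempty S → w ∉ S → _∈∂_ G w S
  ∈∂-complete {S} {w} (u , u∈S) w∉S = w∉S , u , u∈S , w∈N
    where
    w≢u : w ≢ u
    w≢u refl = w∉S u∈S
    w∈N : w ∈ N G u
    w∈N with pos G w u in sign
    ... | true  = x∈p∪q⁺ (inj₁ (from ∈-tabulate (from not-≟∧-≡true (w≢u , sign))))
    ... | false = x∈p∪q⁺ (inj₂ (from ∈-tabulate (from not-≟∧-≡true (w≢u , cong not sign))))

  AttackedAt : Subset n → Fin n → Set
  AttackedAt S w = deg⁺ G S w ≤ deg⁻ G S w × deg⁺ G (∁ S) w + 1 ≤ deg⁻ G S w

  alliance⇔pointwise : ∀ {S} {A : Fin n → Set} → Nonempty S → (∀ {w} → w ∉ S → AttackedAt S w ⇔ A w) →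
    OffensiveAlliance G S ⇔ (∀ w → w ∉ S → A w)
  alliance⇔pointwise nonempty attacked⇔ = mk⇔
    (λ alliance w w∉S → to (attacked⇔ w∉S) (alliance w (∈∂-complete nonempty w∉S)))
    (λ attacked w (w∉S , _) → from (attacked⇔ w∉S) (attacked w w∉S))

  ⊤-alliance : OffensiveAlliance G ⊤
  ⊤-alliance w (w∉⊤ , _) = contradiction ∈⊤ w∉⊤

  AllianceLowerBound : ℕ → Set
  AllianceLowerBound m = ∀ T → Nonempty T → OffensiveAlliance G T → m ≤ ∣ T ∣

  minimum-of-size : ∀ {S m} → Nonempty S → OffensiveAlliance G S → ∣ S ∣ ≡ m →
    AllianceLowerBound m → MinOffensiveAlliance G S
  minimum-of-size nonempty alliance refl lowerBound = nonempty , alliance , lowerBound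

  aso-of-size : ∀ {S m} → Nonempty S → OffensiveAlliance G S → ∣ S ∣ ≡ m →
    AllianceLowerBound m → AsoIs G m
  aso-of-size {S} nonempty alliance ∣S∣≡m lowerBound =
    S , minimum-of-size nonempty alliance ∣S∣≡m lowerBound , ∣S∣≡m

module _ {n k : ℕ} (c : Fin n → Fin k) where

  -- The alliance conditions at w ∉ S.  In the balanced one, w itself accounts for the + 1
  -- of deg⁺ G (∁ S) w + 1, as w ∈ blockOf c w ∩ ∁ S.
  BalancedAttack : Subset n → Fin n → Set
  BalancedAttack S w =
    ∣ blockOf c w ∩ S ∣ ≤ ∣ ∁ (blockOf c w) ∩ S ∣ × ∣ blockOf c w ∩ ∁ S ∣ ≤ ∣ ∁ (blockOf c w) ∩ S ∣

  AntiBalancedAttack : Subset n → Fin n → Set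
  AntiBalancedAttack S w =
    ∣ ∁ (blockOf c w) ∩ S ∣ ≤ ∣ blockOf c w ∩ S ∣ × ∣ ∁ (blockOf c w) ∩ ∁ S ∣ < ∣ blockOf c w ∩ S ∣

-- Balanced graphs

module Balanced {n k : ℕ} {G : CSG n} {c : Fin n → Fin (suc k)}
  (balanced : WeaklyBalanced G c) (sorted : SizeSorted c) where

  alliance⇔ : ∀ {S} → Nonempty S → OffensiveAlliance G S ⇔ (∀ w → w ∉ S → BalancedAttack c S w)
  alliance⇔ {S} nonempty = alliance⇔pointwise G nonempty λ {w} w∉S → ≤×≤-cong
    (trans (deg⁺≡ G S positive) (cong ∣_∣ (x∉p⇒p-x≡p (w∉S ∘ p∩q⊆q (blockOf c w) S))))
    (trans (deg⁻≡ G S (SignSide-∁ G positive)) (cong ∣_∣ (x∉p⇒p-x≡p (w∉S ∘ p∩q⊆q (∁ (blockOf c w)) S))))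
    (trans (cong (_+ 1) (deg⁺≡ G (∁ S) positive))
           (x∈p⇒∣p-x∣+1≡∣p∣ (x∈p∩q⁺ (w∈blockOf c w , x∉p⇒x∈∁p w∉S))))
    where
    positive : ∀ {w} → SignSide G true w (blockOf c w)
    positive = blockOf-SignSide c {G} (proj₁ balanced) (proj₂ balanced)

  onto : ∀ i → ∃[ v ] (c v ≡ i)
  onto = proj₂ (proj₂ (proj₁ balanced))

  attack₂-of-large : ∀ {S} w → ∣ Block c 0 ∣ ≤ ∣ S ∣ → ∣ blockOf c w ∩ ∁ S ∣ ≤ ∣ ∁ (blockOf c w) ∩ S ∣
  attack₂-of-large {S} w large = +-cancelˡ-≤ ∣ B ∩ S ∣ _ _ (begin
    ∣ B ∩ S ∣ + ∣ B ∩ ∁ S ∣   ≡⟨ ∣p∣≡∣p∩q∣+∣p∩∁q∣ B S ⟨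
    ∣ B ∣                   ≤⟨ ∣blockOf∣≤∣Block0∣ c sorted w ⟩
    ∣ Block c 0 ∣           ≤⟨ large ⟩
    ∣ S ∣                   ≡⟨ ∣q∣≡∣p∩q∣+∣∁p∩q∣ B S ⟩
    ∣ B ∩ S ∣ + ∣ ∁ B ∩ S ∣ ∎)
    where
    open ≤-Reasoning
    B = blockOf c w

  Block0-alliance : OffensiveAlliance G (Block c 0)
  Block0-alliance = from (alliance⇔ (Block0-nonempty c onto))
    λ w w∉V₁ → ≤-trans (≤-reflexive (Empty⇒∣p∣≡0 (disjoint w∉V₁))) z≤n , attack₂-of-large w ≤-refl
    where
    disjoint : ∀ {w} → w ∉ Block c 0 → Empty (blockOf c w ∩ Block c 0)
    disjoint w∉V₁ (u , u∈) = let u∈B , u∈V₁ = x∈p∩q⁻ _ _ u∈ in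
      w∉V₁ (from (∈Block⇔ c) (trans (cong toℕ (sym (to (∈blockOf⇔ c) u∈B))) (to (∈Block⇔ c) u∈V₁)))

  Block0-lowerBound : AllianceLowerBound G ∣ Block c 0 ∣
  Block0-lowerBound T nonempty alliance with nonempty? (Block c 0 ∩ ∁ T)
  ... | no  V₁⊆T = p⊆q⇒∣p∣≤∣q∣ λ u∈V₁ → x∉∁p⇒x∈p λ u∈∁T → V₁⊆T (_ , x∈p∩q⁺ (u∈V₁ , u∈∁T))
  ... | yes (w , w∈) = begin
    ∣ Block c 0 ∣             ≡⟨ cong ∣_∣ (blockOf≡Block c w∈V₁) ⟨
    ∣ B ∣                     ≡⟨ ∣p∣≡∣p∩q∣+∣p∩∁q∣ B T ⟩
    ∣ B ∩ T ∣ + ∣ B ∩ ∁ T ∣   ≤⟨ +-monoʳ-≤ ∣ B ∩ T ∣ (proj₂ attacked) ⟩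
    ∣ B ∩ T ∣ + ∣ ∁ B ∩ T ∣   ≡⟨ ∣q∣≡∣p∩q∣+∣∁p∩q∣ B T ⟨
    ∣ T ∣                     ∎
    where
    open ≤-Reasoning
    B = blockOf c w
    w∈V₁ = proj₁ (x∈p∩q⁻ _ _ w∈)
    attacked = to (alliance⇔ nonempty) alliance w (x∈∁p⇒x∉p (proj₂ (x∈p∩q⁻ _ _ w∈)))

  Block0-minimum : MinOffensiveAlliance G (Block c 0)
  Block0-minimum = Block0-nonempty c onto , Block0-alliance , Block0-lowerBound

  Block0-aso : AsoIs G ∣ Block c 0 ∣
  Block0-aso = Block c 0 , Block0-minimum , refl

  module Pieces {p : ℕ} (ix : Fin p → Fin (suc k)) (Ss : Fin p → Subset n) (S : Subset n)
    (2≤p : 2 ≤ p) (ix-mono : ∀ a b → a F.< b → ix a F.< ix b)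
    (Ss-nonempty : ∀ j → Nonempty (Ss j)) (Ss⊆Block : ∀ j → Ss j ⊆ Block c (toℕ (ix j)))
    (Ss⊆S : ∀ j → Ss j ⊆ S) (S⊆⋃Ss : ∀ v → v ∈ S → ∃[ j ] (v ∈ Ss j)) where

    ix-injective : ∀ {a b} → ix a ≡ ix b → a ≡ b
    ix-injective {a} {b} ixa≡ixb with F.<-cmp a b
    ... | tri< a<b _ _ = contradiction (ix-mono a b a<b) (F.<-irrefl ixa≡ixb)
    ... | tri≈ _ a≡b _ = a≡b
    ... | tri> _ _ b<a = contradiction (ix-mono b a b<a) (F.<-irrefl (sym ixa≡ixb))

    S-nonempty : Nonempty S
    S-nonempty = let v , v∈ = Ss-nonempty j₀ in v , Ss⊆S j₀ v∈
      where
      j₀ : Fin p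
      j₀ = F.fromℕ< (≤-trans (s≤s z≤n) 2≤p)

    blockOf∩S≡Ss : ∀ {w} j → w ∈ Block c (toℕ (ix j)) → blockOf c w ∩ S ≡ Ss j
    blockOf∩S≡Ss {w} j w∈ = trans (cong (λ i → Block c i ∩ S) (to (∈Block⇔ c) w∈)) (⊆-antisym
      (λ u∈ → let u∈Block , u∈S = x∈p∩q⁻ _ _ u∈
                  j′ , u∈Ss = S⊆⋃Ss _ u∈S
              in subst (λ i → _ ∈ Ss i)
                   (ix-injective (F.toℕ-injective (trans (sym (to (∈Block⇔ c) (Ss⊆Block j′ u∈Ss)))
                                                         (to (∈Block⇔ c) u∈Block))))
                   u∈Ss)
      (λ u∈Ss → x∈p∩q⁺ (Ss⊆Block j u∈Ss , Ss⊆S j u∈Ss)))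

    HalfCondition : Set
    HalfCondition = ∀ j → Nonempty (Block c (toℕ (ix j)) ─ Ss j) → 2 * ∣ Ss j ∣ ≤ ∣ Block c 0 ∣

    minimum⇒ : MinOffensiveAlliance G S → ∣ S ∣ ≡ ∣ Block c 0 ∣ × HalfCondition
    minimum⇒ (nonempty , alliance , minimal) = ∣S∣≡∣V₁∣ , half
      where
      ∣S∣≡∣V₁∣ : ∣ S ∣ ≡ ∣ Block c 0 ∣
      ∣S∣≡∣V₁∣ = ≤-antisym (minimal _ (proj₁ Block0-minimum) Block0-alliance)
                           (Block0-lowerBound S nonempty alliance)
      half : HalfCondition
      half j (w , w∈) = subst₂ (λ x y → 2 * ∣ x ∣ ≤ y) (blockOf∩S≡Ss j w∈Block) ∣S∣≡∣V₁∣
        (to (∣p∩q∣≤∣∁p∩q∣⇔ (blockOf c w) S) (proj₁ (to (alliance⇔ nonempty) alliance w w∉S)))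
        where
        w∈Block = p─q⊆p _ _ w∈
        w∉S : w ∉ S
        w∉S w∈S = x∈p─q⇒x∉q _ _ w∈ (subst (w ∈_) (blockOf∩S≡Ss j w∈Block) (x∈p∩q⁺ (w∈blockOf c w , w∈S)))

    ⇒minimum : ∣ S ∣ ≡ ∣ Block c 0 ∣ × HalfCondition → MinOffensiveAlliance G S
    ⇒minimum (∣S∣≡∣V₁∣ , half) = minimum-of-size G S-nonempty alliance ∣S∣≡∣V₁∣ Block0-lowerBound
      where
      attack₁ : ∀ {w} → w ∉ S → ∣ blockOf c w ∩ S ∣ ≤ ∣ ∁ (blockOf c w) ∩ S ∣
      attack₁ {w} w∉S with nonempty? (blockOf c w ∩ S)
      ... | no  empty = ≤-trans (≤-reflexive (Empty⇒∣p∣≡0 empty)) z≤n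
      ... | yes (u , u∈) = from (∣p∩q∣≤∣∁p∩q∣⇔ (blockOf c w) S)
        (subst₂ (λ x y → 2 * ∣ x ∣ ≤ y) (sym (blockOf∩S≡Ss j w∈Block)) (sym ∣S∣≡∣V₁∣)
          (half j (w , x∈p∧x∉q⇒x∈p─q w∈Block (w∉S ∘ Ss⊆S j))))
        where
        u∈S : u ∈ S
        u∈S = proj₂ (x∈p∩q⁻ _ _ u∈)
        j = proj₁ (S⊆⋃Ss u u∈S)
        w∈Block : w ∈ Block c (toℕ (ix j))
        w∈Block = from (∈Block⇔ c) (trans (cong toℕ (sym (to (∈blockOf⇔ c) (proj₁ (x∈p∩q⁻ _ _ u∈)))))
                                          (to (∈Block⇔ c) (Ss⊆Block j (proj₂ (S⊆⋃Ss u u∈S)))))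
      alliance : OffensiveAlliance G S
      alliance = from (alliance⇔ S-nonempty) λ w w∉S →
        attack₁ w∉S , attack₂-of-large w (≤-reflexive (sym ∣S∣≡∣V₁∣))

    minimum⇔ : MinOffensiveAlliance G S ⇔ (∣ S ∣ ≡ ∣ Block c 0 ∣ × HalfCondition)
    minimum⇔ = mk⇔ minimum⇒ ⇒minimum

-- Anti-balanced graphs

module AntiBalanced {n k : ℕ} {G : CSG n} {c : Fin n → Fin (suc k)}
  (antiBalanced : WeaklyAntiBalanced G c) (sorted : SizeSorted c) where

  alliance⇔ : ∀ {S} → Nonempty S → OffensiveAlliance G S ⇔ (∀ w → w ∉ S → AntiBalancedAttack c S w)
  alliance⇔ {S} nonempty = alliance⇔pointwise G nonempty λ {w} w∉S → ≤×≤-cong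
    (trans (deg⁺≡ G S positive) (cong ∣_∣ (x∉p⇒p-x≡p (w∉S ∘ p∩q⊆q (∁ (blockOf c w)) S))))
    (trans (deg⁻≡ G S negative) (cong ∣_∣ (x∉p⇒p-x≡p (w∉S ∘ p∩q⊆q (blockOf c w) S))))
    (trans (+-comm _ 1) (cong suc (trans (deg⁺≡ G (∁ S) positive) (cong ∣_∣ (x∉p⇒p-x≡p
      (x∈p⇒x∉∁p (w∈blockOf c w) ∘ p∩q⊆p (∁ (blockOf c w)) (∁ S)))))))
    where
    negative : ∀ {w} → SignSide G false w (blockOf c w)
    negative = blockOf-SignSide c {G} (proj₁ antiBalanced) (proj₂ antiBalanced)
    positive : ∀ {w} → SignSide G true w (∁ (blockOf c w))
    positive = SignSide-∁ G negative

  onto : ∀ i → ∃[ v ] (c v ≡ i)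
  onto = proj₂ (proj₂ (proj₁ antiBalanced))

  attack-of-split : ∀ {S₁ S₂ P} w → blockOf c w ≡ P → S₁ ⊆ P → S₂ ⊆ ∁ P →
    ∣ S₂ ∣ ≤ ∣ S₁ ∣ → ∣ ∁ P ∣ < ∣ S₁ ∣ + ∣ S₂ ∣ → AntiBalancedAttack c (S₁ ∪ S₂) w
  attack-of-split {S₁} {S₂} {P} w refl S₁⊆P S₂⊆∁P ∣S₂∣≤∣S₁∣ ∣∁P∣<∣S∣ =
    subst₂ _≤_ (cong ∣_∣ (sym (∁p∩[q∪r]≡r S₁⊆P S₂⊆∁P))) ∣S₁∣≡∣P∩S∣ ∣S₂∣≤∣S₁∣ ,
    subst (∣ ∁ P ∩ ∁ (S₁ ∪ S₂) ∣ <_) ∣S₁∣≡∣P∩S∣ (+-cancelʳ-< ∣ S₂ ∣ _ _ (begin-strict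
      ∣ ∁ P ∩ ∁ (S₁ ∪ S₂) ∣ + ∣ S₂ ∣                    ≡⟨ +-comm _ ∣ S₂ ∣ ⟩
      ∣ S₂ ∣ + ∣ ∁ P ∩ ∁ (S₁ ∪ S₂) ∣                    ≡⟨ cong (λ q → ∣ q ∣ + ∣ ∁ P ∩ ∁ (S₁ ∪ S₂) ∣)
                                                              (∁p∩[q∪r]≡r S₁⊆P S₂⊆∁P) ⟨
      ∣ ∁ P ∩ (S₁ ∪ S₂) ∣ + ∣ ∁ P ∩ ∁ (S₁ ∪ S₂) ∣       ≡⟨ ∣p∣≡∣p∩q∣+∣p∩∁q∣ (∁ P) (S₁ ∪ S₂) ⟨
      ∣ ∁ P ∣                                          <⟨ ∣∁P∣<∣S∣ ⟩
      ∣ S₁ ∣ + ∣ S₂ ∣                                  ∎))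
    where
    open ≤-Reasoning
    ∣S₁∣≡∣P∩S∣ : ∣ S₁ ∣ ≡ ∣ P ∩ (S₁ ∪ S₂) ∣
    ∣S₁∣≡∣P∩S∣ = sym (cong ∣_∣ (p∩[q∪r]≡q S₁⊆P S₂⊆∁P))

  data ComplementShape (T : Subset n) : Set where
    full         : (∀ u → u ∈ T) → ComplementShape T
    withinBlock  : ∀ {w} → w ∉ T → (∀ u → u ∉ T → c u ≡ c w) → ComplementShape T
    acrossBlocks : ∀ {w w′} → w ∉ T → w′ ∉ T → c w ≢ c w′ → ComplementShape T

  complementShape : ∀ T → ComplementShape T
  complementShape T with nonempty? (∁ T)
  ... | no ∁T-empty = full λ u → x∉∁p⇒x∈p λ u∈∁T → ∁T-empty (u , u∈∁T)
  ... | yes (w , w∈∁T) with nonempty? (∁ T ∩ ∁ (blockOf c w))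
  ...   | yes (w′ , w′∈) = acrossBlocks (x∈∁p⇒x∉p w∈∁T) (x∈∁p⇒x∉p (proj₁ (x∈p∩q⁻ _ _ w′∈)))
            λ cw≡cw′ → x∈∁p⇒x∉p (proj₂ (x∈p∩q⁻ _ _ w′∈)) (from (∈blockOf⇔ c) (sym cw≡cw′))
  ...   | no  empty = withinBlock (x∈∁p⇒x∉p w∈∁T) λ u u∉T → to (∈blockOf⇔ c)
            (x∉∁p⇒x∈p λ u∈∁B → empty (u , x∈p∩q⁺ (x∉p⇒x∈∁p u∉T , u∈∁B)))

  module _ {T : Subset n} (nonempty : Nonempty T) (alliance : OffensiveAlliance G T) where

    attacked : ∀ {w} → w ∉ T → AntiBalancedAttack c T w
    attacked {w} w∉T = to (alliance⇔ nonempty) alliance w w∉T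

    ∣∁blockOf∣<∣T∣ : ∀ {w} → w ∉ T → ∣ ∁ (blockOf c w) ∣ < ∣ T ∣
    ∣∁blockOf∣<∣T∣ {w} w∉T = begin-strict
      ∣ ∁ B ∣                     ≡⟨ ∣p∣≡∣p∩q∣+∣p∩∁q∣ (∁ B) T ⟩
      ∣ ∁ B ∩ T ∣ + ∣ ∁ B ∩ ∁ T ∣ <⟨ +-monoʳ-< ∣ ∁ B ∩ T ∣ (proj₂ (attacked w∉T)) ⟩
      ∣ ∁ B ∩ T ∣ + ∣ B ∩ T ∣     ≡⟨ +-comm ∣ ∁ B ∩ T ∣ ∣ B ∩ T ∣ ⟩
      ∣ B ∩ T ∣ + ∣ ∁ B ∩ T ∣     ≡⟨ ∣q∣≡∣p∩q∣+∣∁p∩q∣ B T ⟨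
      ∣ T ∣                       ∎
      where
      open ≤-Reasoning
      B = blockOf c w

    withinBlock⇒2*[n∸∣Block0∣]≤∣T∣ : ∀ {w} → w ∉ T → (∀ u → u ∉ T → c u ≡ c w) →
      2 * (n ∸ ∣ Block c 0 ∣) ≤ ∣ T ∣
    withinBlock⇒2*[n∸∣Block0∣]≤∣T∣ {w} w∉T within = begin
      2 * (n ∸ ∣ Block c 0 ∣)   ≤⟨ *-monoʳ-≤ 2 (∸-monoʳ-≤ n (∣blockOf∣≤∣Block0∣ c sorted w)) ⟩
      2 * (n ∸ ∣ B ∣)           ≡⟨ cong (2 *_) (∣∁p∣≡n∸∣p∣ B) ⟨
      2 * ∣ ∁ B ∣               ≡⟨ cong (λ p → 2 * ∣ p ∣) ∁B∩T≡∁B ⟨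
      2 * ∣ ∁ B ∩ T ∣           ≤⟨ to x≤y⇔2*x≤x+y (proj₁ (attacked w∉T)) ⟩
      ∣ ∁ B ∩ T ∣ + ∣ B ∩ T ∣   ≡⟨ +-comm ∣ ∁ B ∩ T ∣ ∣ B ∩ T ∣ ⟩
      ∣ B ∩ T ∣ + ∣ ∁ B ∩ T ∣   ≡⟨ ∣q∣≡∣p∩q∣+∣∁p∩q∣ B T ⟨
      ∣ T ∣                     ∎
      where
      open ≤-Reasoning
      B = blockOf c w
      ∁B∩T≡∁B : ∁ B ∩ T ≡ ∁ B
      ∁B∩T≡∁B = ⊆-antisym (p∩q⊆p (∁ B) T) λ u∈∁B → x∈p∩q⁺ (u∈∁B , x∉∁p⇒x∈p λ u∈∁T →
        x∈∁p⇒x∉p u∈∁B (from (∈blockOf⇔ c) (within _ (x∈∁p⇒x∉p u∈∁T))))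

    module Across {w w′ : Fin n} (w∉T : w ∉ T) (w′∉T : w′ ∉ T) (cw≢cw′ : c w ≢ c w′) where

      private
        B B′ : Subset n
        B  = blockOf c w
        B′ = blockOf c w′

        B⊆∁B′ : B ⊆ ∁ B′
        B⊆∁B′ = blockOf⊆∁blockOf c cw≢cw′

        B′⊆∁B : B′ ⊆ ∁ B
        B′⊆∁B = blockOf⊆∁blockOf c (cw≢cw′ ∘ sym)

      half : ℕ
      half = ∣ B ∩ T ∣

      -- half ≤ ∣∁B′ ∩ T∣ ≤ ∣B′ ∩ T∣ ≤ ∣∁B ∩ T∣ ≤ half, so all four are equal
      half≤∣B′∩T∣ : half ≤ ∣ B′ ∩ T ∣
      half≤∣B′∩T∣ = ≤-trans (p⊆q⇒∣p∣≤∣q∣ (∩-monoˡ B⊆∁B′)) (proj₁ (attacked w′∉T))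

      ∣B′∩T∣≤∣∁B∩T∣ : ∣ B′ ∩ T ∣ ≤ ∣ ∁ B ∩ T ∣
      ∣B′∩T∣≤∣∁B∩T∣ = p⊆q⇒∣p∣≤∣q∣ (∩-monoˡ B′⊆∁B)

      ∣∁B∩T∣≡half : ∣ ∁ B ∩ T ∣ ≡ half
      ∣∁B∩T∣≡half = ≤-antisym (proj₁ (attacked w∉T)) (≤-trans half≤∣B′∩T∣ ∣B′∩T∣≤∣∁B∩T∣)

      ∣B′∩T∣≡half : ∣ B′ ∩ T ∣ ≡ half
      ∣B′∩T∣≡half = ≤-antisym (≤-trans ∣B′∩T∣≤∣∁B∩T∣ (proj₁ (attacked w∉T))) half≤∣B′∩T∣

      ∣T∣≡2*half : ∣ T ∣ ≡ 2 * half
      ∣T∣≡2*half = trans (∣q∣≡∣p∩q∣+∣∁p∩q∣ B T) (trans (cong (half +_) ∣∁B∩T∣≡half) (sym (2*x≡x+x half)))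

      T-labels : ∀ {u} → u ∈ T → c u ≡ c w ⊎ c u ≡ c w′
      T-labels {u} u∈T with u ∈? B
      ... | yes u∈B = inj₁ (to (∈blockOf⇔ c) u∈B)
      ... | no  u∉B =
        inj₂ (to (∈blockOf⇔ c) (proj₁ (x∈p∩q⁻ B′ T (∁B∩T⊆B′∩T (x∈p∩q⁺ (x∉p⇒x∈∁p u∉B , u∈T))))))
        where
        ∁B∩T⊆B′∩T : ∁ B ∩ T ⊆ B′ ∩ T
        ∁B∩T⊆B′∩T = ⊆∧∣q∣≤∣p∣⇒⊇ (∩-monoˡ B′⊆∁B) (≤-reflexive (trans ∣∁B∩T∣≡half (sym ∣B′∩T∣≡half)))

      labels : ∀ z → c z ≡ c w ⊎ c z ≡ c w′
      labels z with c z F.≟ c w | c z F.≟ c w′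
      ... | yes cz≡cw | _          = inj₁ cz≡cw
      ... | no  _     | yes cz≡cw′ = inj₂ cz≡cw′
      ... | no  cz≢cw | no  cz≢cw′ = contradiction half≤0 (<⇒≱ (≤-<-trans z≤n (proj₂ (attacked w∉T))))
        where
        open ≤-Reasoning
        z∉T : z ∉ T
        z∉T z∈T = [ cz≢cw , cz≢cw′ ] (T-labels z∈T)
        Bz∩T-empty : Empty (blockOf c z ∩ T)
        Bz∩T-empty (u , u∈) = let u∈Bz , u∈T = x∈p∩q⁻ _ T u∈ ; cu≡cz = to (∈blockOf⇔ c) u∈Bz in
          [ cz≢cw ∘ trans (sym cu≡cz) , cz≢cw′ ∘ trans (sym cu≡cz) ] (T-labels u∈T)
        half≤0 : half ≤ 0
        half≤0 = begin
          half                      ≤⟨ p⊆q⇒∣p∣≤∣q∣ (∩-monoˡ (blockOf⊆∁blockOf c (cz≢cw ∘ sym))) ⟩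
          ∣ ∁ (blockOf c z) ∩ T ∣   ≤⟨ proj₁ (attacked z∉T) ⟩
          ∣ blockOf c z ∩ T ∣       ≡⟨ Empty⇒∣p∣≡0 Bz∩T-empty ⟩
          0                         ∎

      ∣Block∣<∣T∣ : ∀ i → ∣ Block c (toℕ i) ∣ < ∣ T ∣
      ∣Block∣<∣T∣ i with onto i
      ... | z , refl with labels z
      ...   | inj₁ cz≡cw  = ≤-<-trans (p⊆q⇒∣p∣≤∣q∣ (blockOf⊆∁blockOf c (cw≢cw′ ∘ trans (sym cz≡cw))))
                                      (∣∁blockOf∣<∣T∣ w′∉T)
      ...   | inj₂ cz≡cw′ = ≤-<-trans (p⊆q⇒∣p∣≤∣q∣ (blockOf⊆∁blockOf c (cw≢cw′ ∘ sym ∘ trans (sym cz≡cw′))))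
                                      (∣∁blockOf∣<∣T∣ w∉T)

      half<∣Block∣ : ∀ i → half < ∣ Block c (toℕ i) ∣
      half<∣Block∣ i with onto i
      ... | z , refl with labels z
      ...   | inj₁ cz≡cw  = subst (λ p → half < ∣ p ∣) (sym (blockOf-cong c cz≡cw))
                              (x∈p∧x∉q⇒∣p∩q∣<∣p∣ B T (w∈blockOf c w) w∉T)
      ...   | inj₂ cz≡cw′ = subst₂ (λ h p → h < ∣ p ∣) ∣B′∩T∣≡half (sym (blockOf-cong c cz≡cw′))
                              (x∈p∧x∉q⇒∣p∩q∣<∣p∣ B′ T (w∈blockOf c w′) w′∉T)

    acrossBlocks⇒Case2i : ∀ {w w′} → w ∉ T → w′ ∉ T → c w ≢ c w′ → Case2i c
    acrossBlocks⇒Case2i {w} {w′} w∉T w′∉T cw≢cw′ = twoBlocks , ∣V₂∣≤∣V₁∣ , threshold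
      where
      open Across w∉T w′∉T cw≢cw′
      open ≤-Reasoning
      one : Fin (suc k)
      one = proj₁ (x≢y⇒∃toℕ≡1 cw≢cw′)
      V₂≡Block-one : Block c 1 ≡ Block c (toℕ one)
      V₂≡Block-one = cong (Block c) (sym (proj₂ (x≢y⇒∃toℕ≡1 cw≢cw′)))

      twoBlocks : TwoBlocks c
      twoBlocks v = Data.Sum.map (from (∈Block⇔ c)) (from (∈Block⇔ c)) (n≤1⇒n≡0∨n≡1 (toℕ≤1 among (c v)))
        where
        among : ∀ i → i ≡ c w ⊎ i ≡ c w′
        among i with onto i
        ... | z , refl = labels z

      ∣V₂∣≤∣V₁∣ : ∣ Block c 1 ∣ ≤ ∣ Block c 0 ∣
      ∣V₂∣≤∣V₁∣ = subst (λ p → ∣ p ∣ ≤ ∣ Block c 0 ∣) (sym V₂≡Block-one) (sorted F.zero one z≤n)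

      ∣V₁∣<2*∣V₂∣ : ∣ Block c 0 ∣ < 2 * ∣ Block c 1 ∣
      ∣V₁∣<2*∣V₂∣ = begin-strict
        ∣ Block c 0 ∣       <⟨ ∣Block∣<∣T∣ F.zero ⟩
        ∣ T ∣               ≡⟨ ∣T∣≡2*half ⟩
        2 * half            ≤⟨ *-monoʳ-≤ 2 (<⇒≤ (subst (λ p → half < ∣ p ∣) (sym V₂≡Block-one)
                                                       (half<∣Block∣ one))) ⟩
        2 * ∣ Block c 1 ∣   ∎

      threshold : ⌈ suc n /3⌉ ≤ ∣ Block c 1 ∣
      threshold = from ⌈suc/3⌉≤⇔<3* (begin-strict
        n                                     ≡⟨ n≡∣Block0∣+∣Block1∣ c twoBlocks ⟩
        ∣ Block c 0 ∣ + ∣ Block c 1 ∣         ≡⟨ +-comm ∣ Block c 0 ∣ ∣ Block c 1 ∣ ⟩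
        ∣ Block c 1 ∣ + ∣ Block c 0 ∣         <⟨ +-monoʳ-< ∣ Block c 1 ∣ ∣V₁∣<2*∣V₂∣ ⟩
        ∣ Block c 1 ∣ + 2 * ∣ Block c 1 ∣     ∎)

  module CaseI (case : Case2i c) where

    private
      twoBlocks : TwoBlocks c
      twoBlocks = proj₁ case

      a b h : ℕ
      a = ∣ Block c 0 ∣
      b = ∣ Block c 1 ∣
      h = ⌈ suc a /2⌉

      b≤a : b ≤ a
      b≤a = proj₁ (proj₂ case)

      n≡a+b : n ≡ a + b
      n≡a+b = n≡∣Block0∣+∣Block1∣ c twoBlocks

      h≤b : h ≤ b
      h≤b = <⇒⌈suc/2⌉≤ (+-cancelʳ-< b a (2 * b)
        (subst₂ _<_ n≡a+b (+-comm b (2 * b)) (to ⌈suc/3⌉≤⇔<3* (proj₂ (proj₂ case)))))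

    lowerBound : AllianceLowerBound G (2 * h)
    lowerBound T nonempty alliance with complementShape T
    ... | full all = begin
      2 * h   ≤⟨ *-monoʳ-≤ 2 h≤b ⟩
      2 * b   ≡⟨ 2*x≡x+x b ⟩
      b + b   ≤⟨ +-monoˡ-≤ b b≤a ⟩
      a + b   ≡⟨ trans (sym n≡a+b) (sym (⊤⊆p⇒∣p∣≡n all)) ⟩
      ∣ T ∣   ∎
      where open ≤-Reasoning
    ... | withinBlock w∉T within = begin
      2 * h         ≤⟨ *-monoʳ-≤ 2 h≤b ⟩
      2 * b         ≡⟨ cong (2 *_) (trans (cong (_∸ a) n≡a+b) (m+n∸m≡n a b)) ⟨
      2 * (n ∸ a)   ≤⟨ withinBlock⇒2*[n∸∣Block0∣]≤∣T∣ nonempty alliance w∉T within ⟩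
      ∣ T ∣         ∎
      where open ≤-Reasoning
    ... | acrossBlocks w∉T w′∉T cw≢cw′ = begin
      2 * h         ≤⟨ *-monoʳ-≤ 2 (<⇒⌈suc/2⌉≤ {x = half}
                                       (subst (a <_) ∣T∣≡2*half (∣Block∣<∣T∣ F.zero))) ⟩
      2 * half      ≡⟨ ∣T∣≡2*half ⟨
      ∣ T ∣         ∎
      where
      open ≤-Reasoning
      open Across nonempty alliance w∉T w′∉T cw≢cw′

    module _ {S₁ S₂ : Subset n} (S₁⊆V₁ : S₁ ⊆ Block c 0) (S₂⊆V₂ : S₂ ⊆ Block c 1)
      (∣S₁∣≡h : ∣ S₁ ∣ ≡ h) (∣S₂∣≡h : ∣ S₂ ∣ ≡ h) where

      private
        S₂⊆∁V₁ : S₂ ⊆ ∁ (Block c 0)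
        S₂⊆∁V₁ = subst (S₂ ⊆_) (sym (∁Block0≡Block1 c twoBlocks)) S₂⊆V₂

        S₁⊆∁V₂ : S₁ ⊆ ∁ (Block c 1)
        S₁⊆∁V₂ = subst (S₁ ⊆_) (sym (∁Block1≡Block0 c twoBlocks)) S₁⊆V₁

        ∣S₁∣+∣S₂∣≡2*h : ∣ S₁ ∣ + ∣ S₂ ∣ ≡ 2 * h
        ∣S₁∣+∣S₂∣≡2*h = trans (cong₂ _+_ ∣S₁∣≡h ∣S₂∣≡h) (sym (2*x≡x+x h))

      ∣S₁∪S₂∣≡2*h : ∣ S₁ ∪ S₂ ∣ ≡ 2 * h
      ∣S₁∪S₂∣≡2*h = trans (∣q∪r∣≡∣q∣+∣r∣ S₁⊆V₁ S₂⊆∁V₁) ∣S₁∣+∣S₂∣≡2*h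

      minimum : MinOffensiveAlliance G (S₁ ∪ S₂)
      minimum = minimum-of-size G nonempty alliance ∣S₁∪S₂∣≡2*h lowerBound
        where
        nonempty : Nonempty (S₁ ∪ S₂)
        nonempty = 1≤∣p∣⇒Nonempty (subst (1 ≤_) (sym ∣S₁∪S₂∣≡2*h) (s≤s z≤n))
        a<2*h : a < 2 * h
        a<2*h = <2*⌈suc/2⌉ a
        alliance : OffensiveAlliance G (S₁ ∪ S₂)
        alliance = from (alliance⇔ nonempty) λ w _ → [
          (λ w∈V₁ → attack-of-split w (blockOf≡Block c w∈V₁) S₁⊆V₁ S₂⊆∁V₁
            (≤-reflexive (trans ∣S₂∣≡h (sym ∣S₁∣≡h)))
            (subst₂ _<_ (cong ∣_∣ (sym (∁Block0≡Block1 c twoBlocks))) (sym ∣S₁∣+∣S₂∣≡2*h)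
                        (≤-<-trans b≤a a<2*h))) ,
          (λ w∈V₂ → subst (λ S → AntiBalancedAttack c S w) (∪-comm S₂ S₁)
            (attack-of-split w (blockOf≡Block c w∈V₂) S₂⊆V₂ S₁⊆∁V₂
              (≤-reflexive (trans ∣S₁∣≡h (sym ∣S₂∣≡h)))
              (subst₂ _<_ (cong ∣_∣ (sym (∁Block1≡Block0 c twoBlocks)))
                          (trans (sym ∣S₁∣+∣S₂∣≡2*h) (+-comm ∣ S₁ ∣ ∣ S₂ ∣)) a<2*h))) ] (twoBlocks w)

    aso : AsoIs G (2 * h)
    aso = let S₁ , S₁⊆V₁ , ∣S₁∣≡h = ⊆-of-size h (Block c 0) (≤-trans h≤b b≤a)
              S₂ , S₂⊆V₂ , ∣S₂∣≡h = ⊆-of-size h (Block c 1) h≤b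
          in S₁ ∪ S₂ , minimum S₁⊆V₁ S₂⊆V₂ ∣S₁∣≡h ∣S₂∣≡h , ∣S₁∪S₂∣≡2*h S₁⊆V₁ S₂⊆V₂ ∣S₁∣≡h ∣S₂∣≡h

  private
    ∣Block0∣≤n : ∣ Block c 0 ∣ ≤ n
    ∣Block0∣≤n = ∣p∣≤n (Block c 0)

  module CaseII (notI : ¬ Case2i c) (n≤2a : n ≤ 2 * ∣ Block c 0 ∣) where

    private
      a m : ℕ
      a = ∣ Block c 0 ∣
      m = n ∸ a

      m≤a : m ≤ a
      m≤a = m≤n+o⇒m∸n≤o n a (subst (n ≤_) (2*x≡x+x a) n≤2a)

      ∣∁V₁∣≡m : ∣ ∁ (Block c 0) ∣ ≡ m
      ∣∁V₁∣≡m = ∣∁p∣≡n∸∣p∣ (Block c 0)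

    lowerBound : AllianceLowerBound G ((m + 1) ⊔ (2 * m))
    lowerBound T nonempty alliance = [m+1]⊔2*m≤ {m} (Nonempty⇒1≤∣p∣ nonempty) 2*m≤∣T∣
      where
      2*m≤∣T∣ : 2 * m ≤ ∣ T ∣
      2*m≤∣T∣ with complementShape T
      ... | full all = subst (2 * m ≤_) (sym (⊤⊆p⇒∣p∣≡n all)) (from (2*[n∸a]≤n⇔n≤2*a ∣Block0∣≤n) n≤2a)
      ... | withinBlock w∉T within = withinBlock⇒2*[n∸∣Block0∣]≤∣T∣ nonempty alliance w∉T within
      ... | acrossBlocks w∉T w′∉T cw≢cw′ =
        contradiction (acrossBlocks⇒Case2i nonempty alliance w∉T w′∉T cw≢cw′) notI

    -- m ⊔ 1 rather than m covers m = 0, i.e. V = V₁, where a single vertex is a minimum alliance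
    module _ {S₁ : Subset n} (S₁⊆V₁ : S₁ ⊆ Block c 0) (∣S₁∣≡m⊔1 : ∣ S₁ ∣ ≡ m ⊔ 1) where

      ∣S₁∪∁V₁∣≡[m+1]⊔2*m : ∣ S₁ ∪ ∁ (Block c 0) ∣ ≡ (m + 1) ⊔ (2 * m)
      ∣S₁∪∁V₁∣≡[m+1]⊔2*m = begin
        ∣ S₁ ∪ ∁ (Block c 0) ∣        ≡⟨ ∣q∪r∣≡∣q∣+∣r∣ S₁⊆V₁ (λ x∈ → x∈) ⟩
        ∣ S₁ ∣ + ∣ ∁ (Block c 0) ∣    ≡⟨ cong₂ _+_ ∣S₁∣≡m⊔1 ∣∁V₁∣≡m ⟩
        (m ⊔ 1) + m                   ≡⟨ [m⊔1]+m≡[m+1]⊔2*m m ⟩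
        (m + 1) ⊔ (2 * m)             ∎
        where open ≡-Reasoning

      minimum : MinOffensiveAlliance G (S₁ ∪ ∁ (Block c 0))
      minimum = minimum-of-size G nonempty alliance ∣S₁∪∁V₁∣≡[m+1]⊔2*m lowerBound
        where
        1≤∣S₁∣ : 1 ≤ ∣ S₁ ∣
        1≤∣S₁∣ = subst (1 ≤_) (sym ∣S₁∣≡m⊔1) (m≤n⊔m m 1)
        nonempty : Nonempty (S₁ ∪ ∁ (Block c 0))
        nonempty = let v , v∈S₁ = 1≤∣p∣⇒Nonempty 1≤∣S₁∣ in v , p⊆p∪q _ v∈S₁
        alliance : OffensiveAlliance G (S₁ ∪ ∁ (Block c 0))
        alliance = from (alliance⇔ nonempty) λ w w∉S → attack-of-split w
          (blockOf≡Block c (x∉∁p⇒x∈p (w∉S ∘ q⊆p∪q S₁ _))) S₁⊆V₁ (λ x∈ → x∈)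
          (subst₂ _≤_ (sym ∣∁V₁∣≡m) (sym ∣S₁∣≡m⊔1) (m≤m⊔n m 1))
          (+-monoˡ-< ∣ ∁ (Block c 0) ∣ 1≤∣S₁∣)

    aso : AsoIs G ((m + 1) ⊔ (2 * m))
    aso = let S₁ , S₁⊆V₁ , ∣S₁∣≡m⊔1 = ⊆-of-size (m ⊔ 1) (Block c 0)
                                        (⊔-lub m≤a (Nonempty⇒1≤∣p∣ (Block0-nonempty c onto)))
          in S₁ ∪ ∁ (Block c 0) , minimum S₁⊆V₁ ∣S₁∣≡m⊔1 , ∣S₁∪∁V₁∣≡[m+1]⊔2*m S₁⊆V₁ ∣S₁∣≡m⊔1

    minimum-if-1≤k : 1 ≤ k → ∀ S₁ → S₁ ⊆ Block c 0 → ∣ S₁ ∣ ≡ m →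
      MinOffensiveAlliance G (S₁ ∪ ∁ (Block c 0))
    minimum-if-1≤k 1≤k S₁ S₁⊆V₁ ∣S₁∣≡m = minimum S₁⊆V₁ (trans ∣S₁∣≡m (sym (m≥n⇒m⊔n≡m 1≤m)))
      where
      1≤m : 1 ≤ m
      1≤m with onto (F.fromℕ< (s≤s 1≤k))
      ... | v , cv≡1 = subst (1 ≤_) ∣∁V₁∣≡m (Nonempty⇒1≤∣p∣ (v , x∉p⇒x∈∁p λ v∈V₁ →
        0≢1+n (trans (sym (to (∈Block⇔ c) v∈V₁)) (trans (cong toℕ cv≡1) (F.toℕ-fromℕ< (s≤s 1≤k))))))

  module CaseIII (notI : ¬ Case2i c) (n≰2a : ¬ n ≤ 2 * ∣ Block c 0 ∣) where

    lowerBound : AllianceLowerBound G n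
    lowerBound T nonempty alliance with complementShape T
    ... | full all = ≤-reflexive (sym (⊤⊆p⇒∣p∣≡n all))
    ... | withinBlock w∉T within = contradiction (to (2*[n∸a]≤n⇔n≤2*a ∣Block0∣≤n)
            (≤-trans (withinBlock⇒2*[n∸∣Block0∣]≤∣T∣ nonempty alliance w∉T within) (∣p∣≤n T))) n≰2a
    ... | acrossBlocks w∉T w′∉T cw≢cw′ =
      contradiction (acrossBlocks⇒Case2i nonempty alliance w∉T w′∉T cw≢cw′) notI

    aso : AsoIs G n
    aso = aso-of-size G (proj₁ (Block0-nonempty c onto) , ∈⊤) (⊤-alliance G) (∣⊤∣≡n n) lowerBound

theorem1 :
  (∀ (n k : ℕ) (G : CSG n) (c : Fin n → Fin (suc k)) →
    WeaklyBalanced G c → SizeSorted c →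
    (AsoIs G ∣ Block c 0 ∣ × MinOffensiveAlliance G (Block c 0)) ×
    (∀ (p : ℕ) (ix : Fin p → Fin (suc k)) (Ss : Fin p → Subset n) (S : Subset n) →
      2 ≤ p →
      (∀ a b → a F.< b → ix a F.< ix b) →
      (∀ j → Nonempty (Ss j)) →
      (∀ j → Ss j ⊆ Block c (toℕ (ix j))) →
      (∀ j → Ss j ⊆ S) →
      (∀ v → v ∈ S → ∃[ j ] (v ∈ Ss j)) →
      (MinOffensiveAlliance G S ⇔
        ((∣ S ∣ ≡ ∣ Block c 0 ∣) ×
         (∀ j → Nonempty (Block c (toℕ (ix j)) ─ Ss j) →
            2 * ∣ Ss j ∣ ≤ ∣ Block c 0 ∣))))) ×
  (∀ (n k : ℕ) (G : CSG n) (c : Fin n → Fin (suc k)) →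
    WeaklyAntiBalanced G c → SizeSorted c →
    (Case2i c →
      AsoIs G (2 * ⌈ suc ∣ Block c 0 ∣ /2⌉) ×
      (∀ S₁ S₂ → S₁ ⊆ Block c 0 → S₂ ⊆ Block c 1 →
        ∣ S₁ ∣ ≡ ⌈ suc ∣ Block c 0 ∣ /2⌉ → ∣ S₂ ∣ ≡ ⌈ suc ∣ Block c 0 ∣ /2⌉ →
        MinOffensiveAlliance G (S₁ ∪ S₂))) ×
    (¬ Case2i c → n ≤ 2 * ∣ Block c 0 ∣ →
      AsoIs G ((n ∸ ∣ Block c 0 ∣ + 1) ⊔ (2 * (n ∸ ∣ Block c 0 ∣))) ×
      (1 ≤ k → ∀ S₁ → S₁ ⊆ Block c 0 → ∣ S₁ ∣ ≡ n ∸ ∣ Block c 0 ∣ →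
        MinOffensiveAlliance G (S₁ ∪ ∁ (Block c 0)))) ×
    (¬ Case2i c → ¬ (n ≤ 2 * ∣ Block c 0 ∣) → AsoIs G n))
theorem1 =
  (λ n k G c balanced sorted → let open Balanced {G = G} {c = c} balanced sorted in
    (Block0-aso , Block0-minimum) ,
    λ p ix Ss S 2≤p ix-mono Ss-nonempty Ss⊆Block Ss⊆S S⊆⋃Ss →
      Pieces.minimum⇔ ix Ss S 2≤p ix-mono Ss-nonempty Ss⊆Block Ss⊆S S⊆⋃Ss) ,
  (λ n k G c antiBalanced sorted → let open AntiBalanced {G = G} {c = c} antiBalanced sorted in
    (λ case → CaseI.aso case , λ S₁ S₂ S₁⊆V₁ S₂⊆V₂ → CaseI.minimum case S₁⊆V₁ S₂⊆V₂) ,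
    (λ notI n≤2a → CaseII.aso notI n≤2a , CaseII.minimum-if-1≤k notI n≤2a) ,
    CaseIII.aso)
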